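{- Let $G_\sigma$ be a signed graph with no positive cycles, at least two edges, and no isolated vertex. The following are equivalent: (1) $G_\sigma$ is lift connected; (2) $G_\sigma$ contains no lift isthmus; (3) $G_\sigma$ has at least two cycles and no isthmus. Moreover, if $G_\sigma$ does not have at least two cycles, then every edge is a lift isthmus.
   Context: A signed graph $G_\sigma$ consists of a finite undirected graph, in which loops and multiple edges are allowed, with a sign $\pm1$ on each edge. Cycles are elementary; a loop is a cycle of length 1. The sign of a cycle is the product of its edge signs. The lift matroid $L(G_\sigma)$ on the edge set has as circuits the edge sets of: (i) positive cycles; (ii) unions of two negative cycles with exactly one common vertex; (iii$'$) unions of two vertex-disjoint negative cycles. A matroid is connected if every two elements lie in a common circuit. $G_\sigma$ is lift connected if $L(G_\sigma)$ is connected or $G_\sigma=K_1$. A lift isthmus is a coloop of $L(G_\sigma)$, i.e. an edge in no lift circuit. An isthmus is an edge whose deletion increases the number of connected components. -}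

module Defs where

open import Data.Nat using (ℕ; zero; suc; _<_)
open import Data.Nat.DivMod using (_mod_)
open import Data.Fin using (Fin; toℕ)
open import Data.Fin.Subset using (Subset; _∈_; _∪_; ∁; ⁅_⁆; ⊤)
open import Data.Vec using (lookup)
open import Data.Bool using (if_then_else_)
open import Data.List using (foldr; map)
open import Data.List.Base using (allFin)
open import Data.Sign using (Sign; _*_) renaming (+ to plus; - to minus)
open import Data.Product using (Σ; ∃; ∃-syntax; _×_; _,_; proj₁; proj₂)
open import Data.Sum using (_⊎_)
open import Relation.Binary.PropositionalEquality using (_≡_; _≢_)
open import Relation.Binary.Construct.Closure.ReflexiveTransitive using (Star)
open import Relation.Nullary using (¬_)
open import Function.Bundles using (_⇔_)
open import Function.Definitions using (Injective)

-- A signed graph: vertices Fin n, edges Fin m; each edge has an (unordered)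
-- pair of endpoints, given as an ordered pair (loops: both ends equal;
-- parallel edges allowed), and a sign.
record SignedGraph : Set where
  field
    n    : ℕ
    m    : ℕ
    ends : Fin m → Fin n × Fin n
    σ    : Fin m → Sign
open SignedGraph public

module _ (G : SignedGraph) where

  Vertex = Fin (n G)
  Edge   = Fin (m G)
  EdgeSet = Subset (m G)

  Joins : Edge → Vertex → Vertex → Set
  Joins e a b = (ends G e ≡ (a , b)) ⊎ (ends G e ≡ (b , a))

  Incident : Vertex → Edge → Set
  Incident x e = (proj₁ (ends G e) ≡ x) ⊎ (proj₂ (ends G e) ≡ x)

  csuc : ∀ {k} → Fin (suc k) → Fin (suc k)
  csuc {k} i = suc (toℕ i) mod (suc k)

  -- C is the edge set of an (elementary) cycle of length suc k:
  -- distinct vertices v_0..v_k, distinct edges e_0..e_k, e_i joins v_i, v_{i+1 mod (k+1)}.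
  IsCycle : EdgeSet → Set
  IsCycle C = ∃[ k ] Σ (Fin (suc k) → Edge) λ f → Σ (Fin (suc k) → Vertex) λ v →
      Injective _≡_ _≡_ f × Injective _≡_ _≡_ v
    × (∀ i → Joins (f i) (v i) (v (csuc i)))
    × (∀ e → (e ∈ C) ⇔ (∃[ i ] f i ≡ e))

  signOf : EdgeSet → Sign
  signOf C = foldr _*_ plus (map (λ e → if lookup C e then σ G e else plus) (allFin (m G)))

  PositiveCycle : EdgeSet → Set
  PositiveCycle C = IsCycle C × signOf C ≡ plus

  NegativeCycle : EdgeSet → Set
  NegativeCycle C = IsCycle C × signOf C ≡ minus

  VOf : EdgeSet → Vertex → Set
  VOf C x = ∃[ e ] (e ∈ C × Incident x e)

  ExactlyOneCommonVertex : EdgeSet → EdgeSet → Set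
  ExactlyOneCommonVertex C D =
    ∃[ x ] (VOf C x × VOf D x × (∀ y → VOf C y → VOf D y → y ≡ x))

  VertexDisjoint : EdgeSet → EdgeSet → Set
  VertexDisjoint C D = ∀ x → VOf C x → ¬ VOf D x

  LiftCircuit : EdgeSet → Set
  LiftCircuit X =
      PositiveCycle X
    ⊎ (∃[ C ] ∃[ D ] (NegativeCycle C × NegativeCycle D × C ≢ D
          × ExactlyOneCommonVertex C D × X ≡ C ∪ D))
    ⊎ (∃[ C ] ∃[ D ] (NegativeCycle C × NegativeCycle D × C ≢ D
          × VertexDisjoint C D × X ≡ C ∪ D))

  LiftMatroidConnected : Set
  LiftMatroidConnected =
    ∀ e f → e ≢ f → ∃[ X ] (LiftCircuit X × e ∈ X × f ∈ X)

  IsK₁ : Set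
  IsK₁ = n G ≡ 1 × m G ≡ 0

  LiftConnected : Set
  LiftConnected = LiftMatroidConnected ⊎ IsK₁

  LiftIsthmus : Edge → Set
  LiftIsthmus e = ∀ X → LiftCircuit X → ¬ (e ∈ X)

  Adj : EdgeSet → Vertex → Vertex → Set
  Adj S a b = ∃[ e ] (e ∈ S × Joins e a b)

  Reach : EdgeSet → Vertex → Vertex → Set
  Reach S = Star (Adj S)

  NumComponents : EdgeSet → ℕ → Set
  NumComponents S k = Σ (Vertex → Fin k) λ c →
    (∀ j → ∃[ v ] c v ≡ j) × (∀ u v → (c u ≡ c v) ⇔ Reach S u v)

  Isthmus : Edge → Set
  Isthmus e = ∃[ k ] ∃[ k' ] (NumComponents ⊤ k × NumComponents (∁ ⁅ e ⁆) k' × k < k')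

  NoPositiveCycle : Set
  NoPositiveCycle = ∀ C → ¬ PositiveCycle C

  NoIsolatedVertex : Set
  NoIsolatedVertex = ∀ x → ∃[ e ] Incident x e

  AtLeastTwoCycles : Set
  AtLeastTwoCycles = ∃[ C ] ∃[ D ] (IsCycle C × IsCycle D × C ≢ D)

module Submission where

-- When no cycle is positive, the lift circuits are the unions of two
-- distinct cycles meeting in at most one vertex.  The key fact is the theta
-- lemma: if two distinct cycles shared two vertices, one of them would
-- contain an ear of the other, i.e. a path between two of its vertices
-- avoiding it otherwise, and the ear would close a positive circle with one
-- of the two arcs of the (negative) cycle.  Hence any two distinct cycles
-- form a lift circuit, and no cycle lies properly inside another.  It
-- follows that an edge is a lift isthmus unless it lies on a cycle and the
-- graph has at least two cycles, while (for any graph) an edge is an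
-- isthmus exactly when it lies on no cycle.  All three conditions of the
-- theorem thus amount to "at least two cycles, and every edge on a cycle".
--
-- The theorem
-- is assembled at the end.

open import Defs
open import Function using (_∘_)
open import Function.Bundles using (_⇔_; mk⇔; Equivalence)
open import Function.Definitions using (Injective)
open import Data.Empty using (⊥; ⊥-elim)
open import Data.Product using (uncurry; Σ; ∃₂; ∃-syntax; _×_; _,_; proj₁; proj₂)
open import Data.Product.Properties using (,-injective) renaming (≡-dec to ×-≡-dec)
open import Data.Sum using (_⊎_; inj₁; inj₂; [_,_]′)
open import Data.Bool using (true; false; if_then_else_; _∨_)
open import Data.Bool.Properties using () renaming (_≟_ to _≟ᵇ_)
open import Data.Nat using (ℕ; zero; suc; _≤_; _<_; s≤s; z<s; s<s; _%_)
open import Data.Nat.Properties using (<⇒≢; <⇒≱; <-trans; ≤-trans; n≤1+n; m≤n⇒m<n∨m≡n)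
open import Data.Nat.DivMod using (_mod_; m<n⇒m%n≡m; n%n≡0; m%n<n)
open import Data.Fin using (Fin; toℕ; fromℕ<) renaming (zero to fzero; suc to fsuc)
open import Data.Fin.Properties using (suc-injective; injective⇒≤; any?; toℕ-injective; toℕ-fromℕ<; toℕ<n) renaming (_≟_ to _≟ᶠ_)
open import Data.Fin.Subset using (Subset; _⊆_; _∪_; ⋃; ⁅_⁆; ∁; ⊤) renaming (_∈_ to _∈ₛ_)
open import Data.Fin.Subset.Properties using (⊆-antisym; ∈⊤; x∈∁p⇒x∉p; x∉p⇒x∈∁p; x≢y⇒x∉⁅y⁆; x∈p∪q⁺; x∈p∪q⁻; x∈⁅x⁆; x∈⁅y⁆⇒x≡y; ∉⊥) renaming (_∈?_ to _∈ₛ?_)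
import Data.Vec as Vec
open import Data.Vec.Properties using (lookup-zipWith; lookup⇒[]=) renaming (≡-dec to Vec-≡-dec)
open import Data.List using (List; []; _∷_; _++_; [_]; reverse; length; lookup; map; foldr; applyUpTo; allFin)
open import Data.List.Properties using (unfold-reverse; ++-conicalˡ; ++-identityʳ; ++-assoc)
open import Data.List.Membership.Propositional using (_∈_; _∉_)
open import Data.List.Membership.Propositional.Properties using (∈-++⁺ˡ; ∈-++⁺ʳ; ∈-++⁻; ∈-lookup; ∈-applyUpTo⁺; ∈-applyUpTo⁻)
open import Data.List.Relation.Unary.Any using (here; there; index)
import Data.List.Relation.Unary.Any as Any
open import Data.List.Relation.Unary.Any.Properties using (lookup-index)
import Data.List.Relation.Unary.All as All
open import Data.List.Relation.Unary.All.Properties using (++⁻ˡ; ++⁻ʳ; ¬Any⇒All¬)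
open import Data.List.Relation.Unary.AllPairs using ([]; _∷_; head; tail)
open import Data.List.Relation.Unary.Unique.Propositional using (Unique)
open import Data.List.Relation.Unary.Unique.Propositional.Properties using (++⁺; applyUpTo⁺₁)
open import Data.List.Relation.Binary.Disjoint.Propositional using (Disjoint)
open import Data.List.Relation.Binary.Permutation.Propositional using (_↭_; ↭-sym; ↭-trans; ↭-reflexive; ↭⇒↭ₛ)
open import Data.List.Relation.Binary.Permutation.Propositional.Properties using (++-comm; ↭-reverse; ↭-empty-inv; ∈-resp-↭)
import Data.List.Relation.Binary.Permutation.Setoid.Properties as Permutationₛ
open import Data.Sign using (Sign; _*_) renaming (+ to plus; - to minus)
open import Data.Sign.Properties using (*-comm; *-identityˡ; *-identityʳ; s*s≡+; *-commutativeSemigroup)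
open import Algebra.Properties.CommutativeSemigroup *-commutativeSemigroup using (interchange)
open import Relation.Binary.PropositionalEquality using (_≡_; _≢_; refl; sym; trans; cong; cong₂; subst; subst₂; setoid; module ≡-Reasoning)
open import Relation.Binary.Construct.Closure.ReflexiveTransitive using (ε; _◅_; _◅◅_)
import Relation.Binary.Construct.Closure.ReflexiveTransitive as Star
open import Relation.Nullary using (¬_; Dec; yes; no; ¬?)
open import Relation.Nullary.Decidable using (_×-dec_; _⊎-dec_; decidable-stable)

Unique-resp-↭ : ∀ {A : Set} {xs ys : List A} → xs ↭ ys → Unique xs → Unique ys
Unique-resp-↭ {A} p = Permutationₛ.Unique-resp-↭ (setoid A) (↭⇒↭ₛ p)

Unique-++⁻ : ∀ {A : Set} (xs : List A) {ys} → Unique (xs ++ ys) →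
  Unique xs × Unique ys × Disjoint xs ys
Unique-++⁻ [] u = [] , u , λ { (() , _) }
Unique-++⁻ (x ∷ xs) (x∉ ∷ u) with Unique-++⁻ xs u
... | uxs , uys , disj = (++⁻ˡ xs x∉ ∷ uxs) , uys , λ
  { (here refl , q) → All.lookup (++⁻ʳ xs x∉) q refl
  ; (there p , q) → disj (p , q) }

Unique-reverse : ∀ {A : Set} (xs : List A) → Unique xs → Unique (reverse xs)
Unique-reverse xs = Unique-resp-↭ (↭-sym (↭-reverse xs))

lookup-injective : ∀ {A : Set} {xs : List A} → Unique xs → ∀ i j → lookup xs i ≡ lookup xs j → i ≡ j
lookup-injective (_ ∷ _) fzero fzero _ = refl
lookup-injective (x∉ ∷ _) fzero (fsuc j) eq = ⊥-elim (All.lookup x∉ (∈-lookup j) eq)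
lookup-injective (x∉ ∷ _) (fsuc i) fzero eq = ⊥-elim (All.lookup x∉ (∈-lookup i) (sym eq))
lookup-injective (_ ∷ u) (fsuc i) (fsuc j) eq = cong fsuc (lookup-injective u i j eq)

Unique-length≤ : ∀ {k} {xs : List (Fin k)} → Unique xs → length xs ≤ k
Unique-length≤ u = injective⇒≤ (lookup-injective u _ _)

toℕ-mod : ∀ {k j} → j < suc k → toℕ (j mod suc k) ≡ j
toℕ-mod j<N = trans (toℕ-fromℕ< _) (m<n⇒m%n≡m j<N)

mod-toℕ : ∀ {k} (i : Fin (suc k)) → toℕ i mod suc k ≡ i
mod-toℕ i = toℕ-injective (toℕ-mod (toℕ<n i))

mod-injective : ∀ {k j j′} → j < suc k → j′ < suc k → j mod suc k ≡ j′ mod suc k → j ≡ j′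
mod-injective j<N j′<N eq = trans (sym (toℕ-mod j<N)) (trans (cong toℕ eq) (toℕ-mod j′<N))

foldr-*-map : ∀ {A : Set} (l : List A) (h f g : A → Sign) → (∀ x → h x ≡ f x * g x) →
  foldr _*_ plus (map h l) ≡ foldr _*_ plus (map f l) * foldr _*_ plus (map g l)
foldr-*-map [] h f g hfg = refl
foldr-*-map (x ∷ l) h f g hfg =
  trans (cong₂ _*_ (hfg x) (foldr-*-map l h f g hfg)) (interchange (f x) (g x) _ _)

theta-sign : ∀ p q₁ q₂ → (p * q₁) * (p * q₂) ≡ q₁ * q₂
theta-sign p q₁ q₂ = begin
  (p * q₁) * (p * q₂) ≡⟨ interchange p q₁ p q₂ ⟩
  (p * p) * (q₁ * q₂) ≡⟨ cong (_* (q₁ * q₂)) (s*s≡+ p) ⟩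
  plus * (q₁ * q₂)    ≡⟨ *-identityˡ (q₁ * q₂) ⟩
  q₁ * q₂             ∎
  where open ≡-Reasoning

*-minus : ∀ s t → s * t ≡ minus → (s ≡ plus) ⊎ (t ≡ plus)
*-minus plus t _ = inj₁ refl
*-minus minus plus _ = inj₂ refl

⊆-or-witness : ∀ {k} (X Y : Subset k) → X ⊆ Y ⊎ ∃[ g ] (g ∈ₛ X × ¬ g ∈ₛ Y)
⊆-or-witness X Y with any? (λ g → (g ∈ₛ? X) ×-dec ¬? (g ∈ₛ? Y))
... | yes witness = inj₂ witness
... | no none = inj₁ λ {g} g∈X → decidable-stable (g ∈ₛ? Y) (λ g∉Y → none (g , g∈X , g∉Y))

-- For the
-- reachability relation of a graph this is 'NumComponents'.
Labelling : ∀ {k} → (Fin k → Fin k → Set) → ℕ → Set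
Labelling {k} R j = Σ (Fin k → Fin j) λ c → (∀ i → ∃[ v ] c v ≡ i) × (∀ u v → (c u ≡ c v) ⇔ R u v)

-- A decidable equivalence relation on Fin k has a labelling: the first
-- element either joins the class of a later one or forms a class of its own.
labelling : ∀ {k} (R : Fin k → Fin k → Set) → (∀ u → R u u) → (∀ {u v} → R u v → R v u) →
  (∀ {u v w} → R u v → R v w → R u w) → (∀ u v → Dec (R u v)) → ∃[ j ] Labelling R j
labelling {zero} R _ _ _ _ = 0 , (λ ()) , (λ ()) , λ ()
labelling {suc k} R rfl sy tr R? with labelling (λ u v → R (fsuc u) (fsuc v)) (rfl ∘ fsuc) sy tr (λ u v → R? (fsuc u) (fsuc v))
... | j , c , onto , exact with any? (R? fzero ∘ fsuc)
...   | yes (u , r) = j , c₀ , (λ i → fsuc (proj₁ (onto i)) , proj₂ (onto i)) , exact₀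
  where
    open Equivalence
    c₀ : Fin (suc k) → Fin j
    c₀ fzero = c u
    c₀ (fsuc w) = c w
    exact₀ : ∀ x y → (c₀ x ≡ c₀ y) ⇔ R x y
    exact₀ fzero fzero = mk⇔ (λ _ → rfl fzero) (λ _ → refl)
    exact₀ fzero (fsuc w) = mk⇔ (λ eq → tr r (to (exact u w) eq)) (λ r′ → from (exact u w) (tr (sy r) r′))
    exact₀ (fsuc w) fzero = mk⇔ (λ eq → sy (tr r (to (exact u w) (sym eq))))
                               (λ r′ → sym (from (exact u w) (tr (sy r) (sy r′))))
    exact₀ (fsuc w) (fsuc w′) = exact w w′
...   | no alone = suc j , c₀ , onto₀ , exact₀
  where
    open Equivalence
    c₀ : Fin (suc k) → Fin (suc j)
    c₀ fzero = fzero
    c₀ (fsuc w) = fsuc (c w)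
    onto₀ : ∀ i → ∃[ v ] c₀ v ≡ i
    onto₀ fzero = fzero , refl
    onto₀ (fsuc i) = fsuc (proj₁ (onto i)) , cong fsuc (proj₂ (onto i))
    exact₀ : ∀ x y → (c₀ x ≡ c₀ y) ⇔ R x y
    exact₀ fzero fzero = mk⇔ (λ _ → rfl fzero) (λ _ → refl)
    exact₀ fzero (fsuc w) = mk⇔ (λ ()) (λ r → ⊥-elim (alone (w , r)))
    exact₀ (fsuc w) fzero = mk⇔ (λ ()) (λ r → ⊥-elim (alone (w , sy r)))
    exact₀ (fsuc w) (fsuc w′) = mk⇔ (to (exact w w′) ∘ suc-injective) (cong fsuc ∘ from (exact w w′))

-- Comparing a finer relation R with a coarser one R′: sending each R′-class
-- to the R-class of a representative is injective, so R′ has at most as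
-- many classes; if some R′-related pair is not R-related it has fewer.
module Coarsening {k} {R R′ : Fin k → Fin k → Set} (R⇒R′ : ∀ {u v} → R u v → R′ u v)
                  {j j′} (L : Labelling R j) (L′ : Labelling R′ j′) where
  open Equivalence
  private
    c = proj₁ L
    c′ = proj₁ L′
    rep : Fin j′ → Fin k
    rep i = proj₁ (proj₁ (proj₂ L′) i)

  ψ : Fin j′ → Fin j
  ψ i = c (rep i)

  ψ-hits : ∀ i x → ψ i ≡ c x → i ≡ c′ x
  ψ-hits i x eq = trans (sym (proj₂ (proj₁ (proj₂ L′) i)))
    (from (proj₂ (proj₂ L′) (rep i) x) (R⇒R′ (to (proj₂ (proj₂ L) (rep i) x) eq)))

  ψ-injective : ∀ {i i′} → ψ i ≡ ψ i′ → i ≡ i′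
  ψ-injective {i} {i′} eq = trans (ψ-hits i (rep i′) eq) (proj₂ (proj₁ (proj₂ L′) i′))

  fewer-classes : j′ ≤ j
  fewer-classes = injective⇒≤ ψ-injective

  strictly-fewer-classes : ∀ {a b} → R′ a b → ¬ R a b → j′ < j
  strictly-fewer-classes {a} {b} R′ab ¬Rab = injective⇒≤ ψ⁺-injective
    where
      ca≢cb : c a ≢ c b
      ca≢cb eq = ¬Rab (to (proj₂ (proj₂ L) a b) eq)
      c′a≡c′b : c′ a ≡ c′ b
      c′a≡c′b = from (proj₂ (proj₂ L′) a b) R′ab
      -- A label missed by ψ: the class c′ a = c′ b can reach at most one of c a, c b.
      missed : ∃[ t ] (∀ i → ψ i ≢ t)
      missed with c a ≟ᶠ ψ (c′ a)
      ... | yes ca≡ = c b , λ i eq → ca≢cb (trans ca≡ (trans (cong ψ (trans c′a≡c′b (sym (ψ-hits i b eq)))) eq))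
      ... | no ca≢ = c a , λ i eq → ca≢ (trans (sym eq) (cong ψ (ψ-hits i a eq)))
      ψ⁺ : Fin (suc j′) → Fin j
      ψ⁺ fzero = proj₁ missed
      ψ⁺ (fsuc i) = ψ i
      ψ⁺-injective : ∀ {i i′} → ψ⁺ i ≡ ψ⁺ i′ → i ≡ i′
      ψ⁺-injective {fzero} {fzero} _ = refl
      ψ⁺-injective {fzero} {fsuc i′} eq = ⊥-elim (proj₂ missed i′ (sym eq))
      ψ⁺-injective {fsuc i} {fzero} eq = ⊥-elim (proj₂ missed i eq)
      ψ⁺-injective {fsuc i} {fsuc i′} eq = cong fsuc (ψ-injective eq)

another : ∀ {k} → 2 ≤ k → (i : Fin k) → ∃[ j ] i ≢ j
another (s≤s (s≤s _)) fzero = fsuc fzero , λ ()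
another (s≤s (s≤s _)) (fsuc i) = fzero , λ ()

module Graph (G : SignedGraph) where

  Joins-sym : ∀ {e a b} → Joins G e a b → Joins G e b a
  Joins-sym (inj₁ p) = inj₂ p
  Joins-sym (inj₂ p) = inj₁ p

  Joins⇒Incidentˡ : ∀ {e a b} → Joins G e a b → Incident G a e
  Joins⇒Incidentˡ (inj₁ refl) = inj₁ refl
  Joins⇒Incidentˡ (inj₂ refl) = inj₂ refl

  Joins⇒Incidentʳ : ∀ {e a b} → Joins G e a b → Incident G b e
  Joins⇒Incidentʳ j = Joins⇒Incidentˡ (Joins-sym j)

  Incident⇒end : ∀ {e a b p} → Joins G e a b → Incident G p e → (p ≡ a) ⊎ (p ≡ b)
  Incident⇒end (inj₁ refl) (inj₁ refl) = inj₁ refl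
  Incident⇒end (inj₁ refl) (inj₂ refl) = inj₂ refl
  Incident⇒end (inj₂ refl) (inj₁ refl) = inj₂ refl
  Incident⇒end (inj₂ refl) (inj₂ refl) = inj₁ refl

  end₁ end₂ : Edge G → Vertex G
  end₁ e = proj₁ (ends G e)
  end₂ e = proj₂ (ends G e)

  between-ends : ∀ {e u v} {R : Vertex G → Vertex G → Set} → (∀ {x y} → R x y → R y x) →
    Joins G e u v → R (end₁ e) (end₂ e) ⇔ R u v
  between-ends sy (inj₁ eq) with ,-injective eq
  ... | refl , refl = mk⇔ (λ r → r) (λ r → r)
  between-ends sy (inj₂ eq) with ,-injective eq
  ... | refl , refl = mk⇔ sy sy

  data Walk : Vertex G → Vertex G → Set where
    nil  : ∀ {x} → Walk x x
    step : ∀ {x y z} (e : Edge G) → Joins G e x y → Walk y z → Walk x z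

  -- The vertex each step departs from (so a closed walk lists its start once).
  vertices : ∀ {x y} → Walk x y → List (Vertex G)
  vertices nil = []
  vertices (step {x} e _ w) = x ∷ vertices w

  edges : ∀ {x y} → Walk x y → List (Edge G)
  edges nil = []
  edges (step e _ w) = e ∷ edges w

  later : ∀ {x y} → Walk x y → List (Vertex G)
  visited : ∀ {x y} → Walk x y → List (Vertex G)
  later nil = []
  later (step e _ w) = visited w
  visited {x} w = x ∷ later w

  vertices-visited : ∀ {x y} (w : Walk x y) → vertices w ++ [ y ] ≡ visited w
  vertices-visited nil = refl
  vertices-visited (step {x} e _ w) = cong (x ∷_) (vertices-visited w)

  infixr 5 _++ʷ_
  _++ʷ_ : ∀ {x y z} → Walk x y → Walk y z → Walk x z
  nil ++ʷ w' = w'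
  step e j w ++ʷ w' = step e j (w ++ʷ w')

  vertices-++ʷ : ∀ {x y z} (w : Walk x y) (w' : Walk y z) → vertices (w ++ʷ w') ≡ vertices w ++ vertices w'
  vertices-++ʷ nil w' = refl
  vertices-++ʷ (step {x} e _ w) w' = cong (x ∷_) (vertices-++ʷ w w')

  edges-++ʷ : ∀ {x y z} (w : Walk x y) (w' : Walk y z) → edges (w ++ʷ w') ≡ edges w ++ edges w'
  edges-++ʷ nil w' = refl
  edges-++ʷ (step e _ w) w' = cong (e ∷_) (edges-++ʷ w w')

  reverseʷ : ∀ {x y} → Walk x y → Walk y x
  reverseʷ nil = nil
  reverseʷ (step e j w) = reverseʷ w ++ʷ step e (Joins-sym j) nil

  edges-reverseʷ : ∀ {x y} (w : Walk x y) → edges (reverseʷ w) ≡ reverse (edges w)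
  edges-reverseʷ nil = refl
  edges-reverseʷ (step e j w) = begin
    edges (reverseʷ w ++ʷ step e (Joins-sym j) nil) ≡⟨ edges-++ʷ (reverseʷ w) _ ⟩
    edges (reverseʷ w) ++ [ e ]                      ≡⟨ cong (_++ [ e ]) (edges-reverseʷ w) ⟩
    reverse (edges w) ++ [ e ]                       ≡⟨ unfold-reverse e (edges w) ⟨
    reverse (e ∷ edges w)                            ∎
    where open ≡-Reasoning

  vertices-reverseʷ : ∀ {x y} (w : Walk x y) → vertices (reverseʷ w) ≡ reverse (later w)
  vertices-reverseʷ nil = refl
  vertices-reverseʷ (step {y = y} e j w) = begin
    vertices (reverseʷ w ++ʷ step e (Joins-sym j) nil) ≡⟨ vertices-++ʷ (reverseʷ w) _ ⟩
    vertices (reverseʷ w) ++ [ y ]                      ≡⟨ cong (_++ [ y ]) (vertices-reverseʷ w) ⟩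
    reverse (later w) ++ [ y ]                          ≡⟨ unfold-reverse y (later w) ⟨
    reverse (visited w)                                 ∎
    where open ≡-Reasoning

  ∈-vertices-reverseʷ : ∀ {x y} (w : Walk x y) {u} → u ∈ vertices (reverseʷ w) → u ∈ later w
  ∈-vertices-reverseʷ w p = ∈-resp-↭ (↭-reverse (later w)) (subst (_ ∈_) (vertices-reverseʷ w) p)

  ∈-edges-reverseʷ : ∀ {x y} (w : Walk x y) {g} → g ∈ edges (reverseʷ w) → g ∈ edges w
  ∈-edges-reverseʷ w p = ∈-resp-↭ (↭-reverse (edges w)) (subst (_ ∈_) (edges-reverseʷ w) p)

  Incident⇒visited : ∀ {x y} (w : Walk x y) {e p} → e ∈ edges w → Incident G p e → p ∈ visited w
  Incident⇒visited (step e j w) (here refl) inc with Incident⇒end j inc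
  ... | inj₁ refl = here refl
  ... | inj₂ refl = there (here refl)
  Incident⇒visited (step e j w) (there q) inc = there (Incident⇒visited w q inc)

  vertex⇒visited : ∀ {x y} (w : Walk x y) {p} → p ∈ vertices w → p ∈ visited w
  vertex⇒visited w p∈ = subst (_ ∈_) (vertices-visited w) (∈-++⁺ˡ p∈)

  distinct⇒nonempty : ∀ {x y} (w : Walk x y) → x ≢ y → edges w ≢ []
  distinct⇒nonempty nil x≢y _ = x≢y refl
  distinct⇒nonempty (step _ _ _) _ ()

  start∈vertices : ∀ {x y} (w : Walk x y) → edges w ≢ [] → x ∈ vertices w
  start∈vertices nil ne = ⊥-elim (ne refl)
  start∈vertices (step _ _ _) _ = here refl

  record Cut {x y} (w : Walk x y) (z : Vertex G) : Set where
    constructor cut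
    field
      front : Walk x z
      back  : Walk z y
      vertices-cut : vertices w ≡ vertices front ++ vertices back
      edges-cut    : edges w ≡ edges front ++ edges back

  cutAt : ∀ {x y} (w : Walk x y) {z} → z ∈ visited w → Cut w z
  cutAt nil (here refl) = cut nil nil refl refl
  cutAt (step e j w) (here refl) = cut nil (step e j w) refl refl
  cutAt (step e j w) (there q) with cutAt w q
  ... | cut A B pv pe = cut (step e j A) B (cong (_ ∷_) pv) (cong (e ∷_) pe)

  record EdgeCut {x y} (w : Walk x y) (e : Edge G) : Set where
    constructor edgeCut
    field
      {p q} : Vertex G
      front : Walk x p
      joins : Joins G e p q
      back  : Walk q y
      vertices-cut : vertices w ≡ vertices front ++ p ∷ vertices back
      edges-cut    : edges w ≡ edges front ++ e ∷ edges back

  cutAtEdge : ∀ {x y} (w : Walk x y) {e} → e ∈ edges w → EdgeCut w e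
  cutAtEdge (step e j w) (here refl) = edgeCut nil j w refl refl
  cutAtEdge (step e j w) (there q) with cutAtEdge w q
  ... | edgeCut A j' B pv pe = edgeCut (step e j A) j' B (cong (_ ∷_) pv) (cong (e ∷_) pe)

  -- A circle is a closed walk through at least one edge repeating neither
  -- a vertex nor an edge: the walk form of an elementary cycle.
  record Circle (c : Vertex G) : Set where
    constructor circle
    field
      walk     : Walk c c
      nonempty : edges walk ≢ []
      uniqueV  : Unique (vertices walk)
      uniqueE  : Unique (edges walk)
  open Circle public

  visited⇒vertex : ∀ {c} (w : Walk c c) → edges w ≢ [] → ∀ {p} → p ∈ visited w → p ∈ vertices w
  visited⇒vertex w ne p∈ with ∈-++⁻ (vertices w) (subst (_ ∈_) (sym (vertices-visited w)) p∈)
  ... | inj₁ q = q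
  visited⇒vertex nil ne p∈ | inj₂ (here refl) = ⊥-elim (ne refl)
  visited⇒vertex (step e j w) ne p∈ | inj₂ (here refl) = here refl

  Incident⇒onCircle : ∀ {c} (C : Circle c) {e p} → e ∈ edges (walk C) → Incident G p e → p ∈ vertices (walk C)
  Incident⇒onCircle C e∈ inc = visited⇒vertex (walk C) (nonempty C) (Incident⇒visited (walk C) e∈ inc)

  record Rotation {c} (C : Circle c) (z : Vertex G) : Set where
    constructor rotation
    field
      rotated    : Circle z
      vertices-↭ : vertices (walk C) ↭ vertices (walk rotated)
      edges-↭    : edges (walk C) ↭ edges (walk rotated)

  rotate : ∀ {c} (C : Circle c) {z} → z ∈ vertices (walk C) → Rotation C z
  rotate (circle w ne uv ue) z∈ with cutAt w (vertex⇒visited w z∈)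
  ... | cut A B pv pe = rotation (circle (B ++ʷ A) ne′ (Unique-resp-↭ vs↭ uv) (Unique-resp-↭ es↭ ue)) vs↭ es↭
    where
      vs↭ : vertices w ↭ vertices (B ++ʷ A)
      vs↭ = subst₂ _↭_ (sym pv) (sym (vertices-++ʷ B A)) (++-comm (vertices A) (vertices B))
      es↭ : edges w ↭ edges (B ++ʷ A)
      es↭ = subst₂ _↭_ (sym pe) (sym (edges-++ʷ B A)) (++-comm (edges A) (edges B))
      ne′ : edges (B ++ʷ A) ≢ []
      ne′ eq = ne (↭-empty-inv (↭-trans es↭ (↭-reflexive eq)))

  edgeSet : List (Edge G) → EdgeSet G
  edgeSet es = ⋃ (map ⁅_⁆ es)

  ∈-edgeSet⁺ : ∀ {e} es → e ∈ es → e ∈ₛ edgeSet es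
  ∈-edgeSet⁺ (e ∷ _) (here refl) = x∈p∪q⁺ (inj₁ (x∈⁅x⁆ e))
  ∈-edgeSet⁺ (_ ∷ es) (there p) = x∈p∪q⁺ (inj₂ (∈-edgeSet⁺ es p))

  ∈-edgeSet⁻ : ∀ {e} es → e ∈ₛ edgeSet es → e ∈ es
  ∈-edgeSet⁻ [] p = ⊥-elim (∉⊥ p)
  ∈-edgeSet⁻ (f ∷ es) p with x∈p∪q⁻ ⁅ f ⁆ (edgeSet es) p
  ... | inj₁ q = here (x∈⁅y⁆⇒x≡y f q)
  ... | inj₂ q = there (∈-edgeSet⁻ es q)

  edgeSet-++ : ∀ xs ys → edgeSet (xs ++ ys) ≡ edgeSet xs ∪ edgeSet ys
  edgeSet-++ xs ys = ⊆-antisym to from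
    where
      to : edgeSet (xs ++ ys) ⊆ edgeSet xs ∪ edgeSet ys
      to p with ∈-++⁻ xs (∈-edgeSet⁻ (xs ++ ys) p)
      ... | inj₁ q = x∈p∪q⁺ (inj₁ (∈-edgeSet⁺ xs q))
      ... | inj₂ q = x∈p∪q⁺ (inj₂ (∈-edgeSet⁺ ys q))
      from : edgeSet xs ∪ edgeSet ys ⊆ edgeSet (xs ++ ys)
      from p with x∈p∪q⁻ (edgeSet xs) (edgeSet ys) p
      ... | inj₁ q = ∈-edgeSet⁺ (xs ++ ys) (∈-++⁺ˡ (∈-edgeSet⁻ xs q))
      ... | inj₂ q = ∈-edgeSet⁺ (xs ++ ys) (∈-++⁺ʳ xs (∈-edgeSet⁻ ys q))

  edgeSet-↭ : ∀ {xs ys} → xs ↭ ys → edgeSet xs ≡ edgeSet ys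
  edgeSet-↭ {xs} {ys} p = ⊆-antisym
    (λ q → ∈-edgeSet⁺ ys (∈-resp-↭ p (∈-edgeSet⁻ xs q)))
    (λ q → ∈-edgeSet⁺ xs (∈-resp-↭ (↭-sym p) (∈-edgeSet⁻ ys q)))

  ladder : ∀ t (V : ℕ → Vertex G) (F : ℕ → Edge G) → (∀ j → j < t → Joins G (F j) (V j) (V (suc j))) →
    ∀ {z} → V t ≡ z → Walk (V 0) z
  ladder zero V F J refl = nil
  ladder (suc t) V F J eq = step (F 0) (J 0 z<s) (ladder t (V ∘ suc) (F ∘ suc) (λ j j<t → J (suc j) (s<s j<t)) eq)

  vertices-ladder : ∀ t V F J {z} (eq : V t ≡ z) → vertices (ladder t V F J eq) ≡ applyUpTo V t
  vertices-ladder zero V F J refl = refl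
  vertices-ladder (suc t) V F J eq = cong (V 0 ∷_) (vertices-ladder t (V ∘ suc) (F ∘ suc) _ eq)

  edges-ladder : ∀ t V F J {z} (eq : V t ≡ z) → edges (ladder t V F J eq) ≡ applyUpTo F t
  edges-ladder zero V F J refl = refl
  edges-ladder (suc t) V F J eq = cong (F 0 ∷_) (edges-ladder t (V ∘ suc) (F ∘ suc) _ eq)

  record CircleOn (C : EdgeSet G) : Set where
    constructor circleOn
    field
      {start}        : Vertex G
      theCircle      : Circle start
      edgeSet-circle : edgeSet (edges (walk theCircle)) ≡ C
  open CircleOn public

  cycle→circle : ∀ {C} → IsCycle G C → CircleOn C
  cycle→circle {C} (k , f , v , f-inj , v-inj , J , mem) =
    circleOn (circle W nonempty-W unique-V unique-E) (⊆-antisym edges⊆C C⊆edges)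
    where
      V : ℕ → Vertex G
      V j = v (j mod suc k)
      F : ℕ → Edge G
      F j = f (j mod suc k)
      joins : ∀ j → j < suc k → Joins G (F j) (V j) (V (suc j))
      joins j j<N = subst (Joins G (F j) (V j) ∘ v) (cong (λ t → suc t mod suc k) (toℕ-mod j<N)) (J (j mod suc k))
      closes : V (suc k) ≡ V 0
      closes = cong v (toℕ-injective (trans (toℕ-fromℕ< _) (n%n≡0 (suc k))))
      W : Walk (V 0) (V 0)
      W = ladder (suc k) V F joins closes
      nonempty-W : edges W ≢ []
      nonempty-W eq with trans (sym (edges-ladder (suc k) V F joins closes)) eq
      ... | ()
      distinct : ∀ {A : Set} (g : Fin (suc k) → A) → Injective _≡_ _≡_ g →
        ∀ {i j} → i < j → j < suc k → g (i mod suc k) ≢ g (j mod suc k)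
      distinct g g-inj i<j j<N eq = <⇒≢ i<j (mod-injective (<-trans i<j j<N) j<N (g-inj eq))
      unique-V : Unique (vertices W)
      unique-V = subst Unique (sym (vertices-ladder (suc k) V F joins closes)) (applyUpTo⁺₁ V (suc k) (distinct v v-inj))
      unique-E : Unique (edges W)
      unique-E = subst Unique (sym (edges-ladder (suc k) V F joins closes)) (applyUpTo⁺₁ F (suc k) (distinct f f-inj))
      edges⊆C : edgeSet (edges W) ⊆ C
      edges⊆C {e} p with ∈-applyUpTo⁻ F (subst (e ∈_) (edges-ladder (suc k) V F joins closes) (∈-edgeSet⁻ (edges W) p))
      ... | j , _ , e≡Fj = Equivalence.from (mem e) (j mod suc k , sym e≡Fj)
      C⊆edges : C ⊆ edgeSet (edges W)
      C⊆edges {e} p with Equivalence.to (mem e) p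
      ... | i , refl = ∈-edgeSet⁺ (edges W) (subst (f i ∈_) (sym (edges-ladder (suc k) V F joins closes))
                         (subst (_∈ applyUpTo F (suc k)) (cong f (mod-toℕ i)) (∈-applyUpTo⁺ F (toℕ<n i))))

  -- The i-th vertex of a walk (its last vertex from the end onwards).
  vertexAt : ∀ {x y} → Walk x y → ℕ → Vertex G
  vertexAt {x} nil _ = x
  vertexAt {x} (step e j w) zero = x
  vertexAt (step e j w) (suc i) = vertexAt w i

  vertexAt-start : ∀ {x y} (w : Walk x y) → vertexAt w 0 ≡ x
  vertexAt-start nil = refl
  vertexAt-start (step e j w) = refl

  vertexAt-end : ∀ {x y} (w : Walk x y) → vertexAt w (length (edges w)) ≡ y
  vertexAt-end nil = refl
  vertexAt-end (step e j w) = vertexAt-end w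

  vertexAt-joins : ∀ {x y} (w : Walk x y) (i : Fin (length (edges w))) →
    Joins G (lookup (edges w) i) (vertexAt w (toℕ i)) (vertexAt w (suc (toℕ i)))
  vertexAt-joins (step e j w) fzero = subst (Joins G e _) (sym (vertexAt-start w)) j
  vertexAt-joins (step e j w) (fsuc i) = vertexAt-joins w i

  vertexAt-∈ : ∀ {x y} (w : Walk x y) {i} → i < length (edges w) → vertexAt w i ∈ vertices w
  vertexAt-∈ (step e j w) {zero} _ = here refl
  vertexAt-∈ (step e j w) {suc i} (s<s i<) = there (vertexAt-∈ w i<)

  vertexAt-injective : ∀ {x y} (w : Walk x y) → Unique (vertices w) → ∀ {i i′} →
    i < length (edges w) → i′ < length (edges w) → vertexAt w i ≡ vertexAt w i′ → i ≡ i′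
  vertexAt-injective (step e j w) u {zero} {zero} _ _ _ = refl
  vertexAt-injective (step e j w) (x∉ ∷ u) {zero} {suc i′} _ (s<s i′<) eq =
    ⊥-elim (All.lookup x∉ (vertexAt-∈ w i′<) eq)
  vertexAt-injective (step e j w) (x∉ ∷ u) {suc i} {zero} (s<s i<) _ eq =
    ⊥-elim (All.lookup x∉ (vertexAt-∈ w i<) (sym eq))
  vertexAt-injective (step e j w) (_ ∷ u) {suc i} {suc i′} (s<s i<) (s<s i′<) eq =
    cong suc (vertexAt-injective w u i< i′< eq)

  vertexAt-mod : ∀ {c} k (w : Walk c c) → length (edges w) ≡ suc k →
    ∀ {j} → j ≤ suc k → vertexAt w (j % suc k) ≡ vertexAt w j
  vertexAt-mod k w len {j} j≤N with m≤n⇒m<n∨m≡n j≤N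
  ... | inj₁ j<N = cong (vertexAt w) (m<n⇒m%n≡m j<N)
  ... | inj₂ refl = begin
    vertexAt w (suc k % suc k)    ≡⟨ cong (vertexAt w) (n%n≡0 (suc k)) ⟩
    vertexAt w 0                  ≡⟨ vertexAt-start w ⟩
    _                             ≡⟨ vertexAt-end w ⟨
    vertexAt w (length (edges w)) ≡⟨ cong (vertexAt w) len ⟩
    vertexAt w (suc k)            ∎
    where open ≡-Reasoning

  circle→cycle : ∀ {c} (C : Circle c) → IsCycle G (edgeSet (edges (walk C)))
  circle→cycle (circle nil ne _ _) = ⊥-elim (ne refl)
  circle→cycle (circle w@(step d _ rest) _ uV uE) = k , f , v ,
      (λ eq → lookup-injective uE _ _ eq) ,
      (λ eq → toℕ-injective (vertexAt-injective w uV (toℕ<n _) (toℕ<n _) eq)) ,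
      joins , λ e → mk⇔ (λ p → let q = ∈-edgeSet⁻ (edges w) p in index q , sym (lookup-index q))
                        (λ { (i , refl) → ∈-edgeSet⁺ (edges w) (∈-lookup i) })
    where
      k = length (edges rest)
      f : Fin (suc k) → Edge G
      f = lookup (edges w)
      v : Fin (suc k) → Vertex G
      v i = vertexAt w (toℕ i)
      wraps : ∀ i → vertexAt w (suc (toℕ i)) ≡ v (csuc G i)
      wraps i = begin
        vertexAt w (suc (toℕ i))         ≡⟨ vertexAt-mod k w refl (toℕ<n i) ⟨
        vertexAt w (suc (toℕ i) % suc k) ≡⟨ cong (vertexAt w) (toℕ-fromℕ< (m%n<n (suc (toℕ i)) (suc k))) ⟨
        v (csuc G i)                     ∎
        where open ≡-Reasoning
      joins : ∀ i → Joins G (f i) (v i) (v (csuc G i))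
      joins i = subst (Joins G (f i) (v i)) (wraps i) (vertexAt-joins w i)

  sign : List (Edge G) → Sign
  sign es = signOf G (edgeSet es)

  signOf-∪ : ∀ (X Y : EdgeSet G) → (∀ {e} → e ∈ₛ X → e ∈ₛ Y → ⊥) → signOf G (X ∪ Y) ≡ signOf G X * signOf G Y
  signOf-∪ X Y disj = foldr-*-map (allFin (m G)) (factor (X ∪ Y)) (factor X) (factor Y) split
    where
      factor : EdgeSet G → Edge G → Sign
      factor Z e = if Vec.lookup Z e then σ G e else plus
      split : ∀ e → factor (X ∪ Y) e ≡ factor X e * factor Y e
      split e rewrite lookup-zipWith _∨_ e X Y with Vec.lookup X e in eX | Vec.lookup Y e in eY
      ... | true  | true  = ⊥-elim (disj (lookup⇒[]= e X eX) (lookup⇒[]= e Y eY))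
      ... | true  | false = sym (*-identityʳ (σ G e))
      ... | false | true  = refl
      ... | false | false = refl

  sign-++ : ∀ xs ys → Disjoint xs ys → sign (xs ++ ys) ≡ sign xs * sign ys
  sign-++ xs ys disj = trans (cong (signOf G) (edgeSet-++ xs ys))
    (signOf-∪ (edgeSet xs) (edgeSet ys) (λ p q → disj (∈-edgeSet⁻ xs p , ∈-edgeSet⁻ ys q)))

  sign-↭ : ∀ {xs ys} → xs ↭ ys → sign xs ≡ sign ys
  sign-↭ p = cong (signOf G) (edgeSet-↭ p)

  sign-++ʷ : ∀ {a b c} (P : Walk a b) (Q : Walk b c) → Disjoint (edges P) (edges Q) →
    sign (edges (P ++ʷ Q)) ≡ sign (edges P) * sign (edges Q)
  sign-++ʷ P Q disj = trans (cong sign (edges-++ʷ P Q)) (sign-++ (edges P) (edges Q) disj)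

  positive-circle : ∀ {c} (C : Circle c) → sign (edges (walk C)) ≡ plus → ∃[ X ] PositiveCycle G X
  positive-circle C pos = edgeSet (edges (walk C)) , circle→cycle C , pos

  record Arcs {c} (C : Circle c) (a b : Vertex G) : Set where
    constructor arcs
    field
      arc₁ : Walk a b
      arc₂ : Walk b a
      vertices-arcs : vertices arc₁ ++ vertices arc₂ ↭ vertices (walk C)
      edges-arcs    : edges arc₁ ++ edges arc₂ ↭ edges (walk C)

  splitCircle : ∀ {c} (C : Circle c) {a b} → a ∈ vertices (walk C) → b ∈ vertices (walk C) → Arcs C a b
  splitCircle C a∈ b∈ with rotate C a∈
  ... | rotation C′ vs↭ es↭ with cutAt (walk C′) (vertex⇒visited (walk C′) (∈-resp-↭ vs↭ b∈))
  ... | cut Q₁ Q₂ pv pe = arcs Q₁ Q₂ (↭-sym (↭-trans vs↭ (↭-reflexive pv))) (↭-sym (↭-trans es↭ (↭-reflexive pe)))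

  record Ear {c} (C : Circle c) (a b : Vertex G) : Set where
    constructor ear
    field
      path     : Walk a b
      distinct : a ≢ b
      start∈C  : a ∈ vertices (walk C)
      end∈C    : b ∈ vertices (walk C)
      uniqueVᵖ : Unique (vertices path)
      uniqueEᵖ : Unique (edges path)
      inner    : ∀ {u} → u ∈ vertices path → u ∈ vertices (walk C) → u ≡ a
      avoids   : ∀ {g} → g ∈ edges path → g ∉ edges (walk C)

  record BackArc {c} (C : Circle c) (a b : Vertex G) : Set where
    constructor backArc
    field
      back    : Walk b a
      uniqueVᵇ : Unique (vertices back)
      uniqueEᵇ : Unique (edges back)
      avoids-a : a ∉ vertices back
      onC      : ∀ {u} → u ∈ vertices back → u ∈ vertices (walk C)
      alongC   : ∀ {g} → g ∈ edges back → g ∈ edges (walk C)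
  open BackArc

  -- Between distinct vertices a, b of C there are two ways back from b to a:
  -- the second arc, and the first arc reversed.  Their signs multiply to the sign of C.
  two-ways-back : ∀ {c a b} (C : Circle c) → a ≢ b → Arcs C a b →
    Σ (BackArc C a b × BackArc C a b) λ (B₁ , B₂) →
      sign (edges (walk C)) ≡ sign (edges (back B₁)) * sign (edges (back B₂))
  two-ways-back {a = a} {b} C a≢b (arcs Q₁ Q₂ vs↭ es↭) =
    (backArc Q₂ (proj₁ (proj₂ uV)) (proj₁ (proj₂ uE)) (λ a∈Q₂ → proj₂ (proj₂ uV) (a∈Q₁ , a∈Q₂))
             (onArcs ∘ ∈-++⁺ʳ (vertices Q₁)) (alongArcs ∘ ∈-++⁺ʳ (edges Q₁)) ,
     backArc (reverseʷ Q₁)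
             (subst Unique (sym (vertices-reverseʷ Q₁)) (Unique-reverse _ (tail visited₁)))
             (subst Unique (sym (edges-reverseʷ Q₁)) (Unique-reverse _ (proj₁ uE)))
             (λ a∈ → All.lookup (head visited₁) (∈-vertices-reverseʷ Q₁ a∈) refl)
             (later₁⊆C ∘ ∈-vertices-reverseʷ Q₁) (alongArcs ∘ ∈-++⁺ˡ ∘ ∈-edges-reverseʷ Q₁)) ,
    (begin
      sign (edges (walk C))                            ≡⟨ sign-↭ es↭ ⟨
      sign (edges Q₁ ++ edges Q₂)                      ≡⟨ sign-++ (edges Q₁) (edges Q₂) (proj₂ (proj₂ uE)) ⟩
      sign (edges Q₁) * sign (edges Q₂)                ≡⟨ *-comm (sign (edges Q₁)) _ ⟩
      sign (edges Q₂) * sign (edges Q₁)                ≡⟨ cong (sign (edges Q₂) *_) sign-reverse ⟨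
      sign (edges Q₂) * sign (edges (reverseʷ Q₁))     ∎)
    where
      open ≡-Reasoning
      onArcs : ∀ {u} → u ∈ vertices Q₁ ++ vertices Q₂ → u ∈ vertices (walk C)
      onArcs = ∈-resp-↭ vs↭
      alongArcs : ∀ {g} → g ∈ edges Q₁ ++ edges Q₂ → g ∈ edges (walk C)
      alongArcs = ∈-resp-↭ es↭
      uV = Unique-++⁻ (vertices Q₁) (Unique-resp-↭ (↭-sym vs↭) (uniqueV C))
      uE = Unique-++⁻ (edges Q₁) (Unique-resp-↭ (↭-sym es↭) (uniqueE C))
      a∈Q₁ : a ∈ vertices Q₁
      a∈Q₁ = start∈vertices Q₁ (distinct⇒nonempty Q₁ a≢b)
      b∈Q₂ : b ∈ vertices Q₂
      b∈Q₂ = start∈vertices Q₂ (distinct⇒nonempty Q₂ (a≢b ∘ sym))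
      -- Q₁ is a path: its end b is not among its departure vertices.
      visited₁ : Unique (visited Q₁)
      visited₁ = subst Unique (vertices-visited Q₁)
        (++⁺ (proj₁ uV) (All.[] ∷ []) λ { (p , here refl) → proj₂ (proj₂ uV) (p , b∈Q₂) })
      later₁⊆C : ∀ {u} → u ∈ later Q₁ → u ∈ vertices (walk C)
      later₁⊆C p with ∈-++⁻ (vertices Q₁) (subst (_ ∈_) (sym (vertices-visited Q₁)) (there p))
      ... | inj₁ q = onArcs (∈-++⁺ˡ q)
      ... | inj₂ (here refl) = onArcs (∈-++⁺ʳ (vertices Q₁) b∈Q₂)
      sign-reverse : sign (edges (reverseʷ Q₁)) ≡ sign (edges Q₁)
      sign-reverse = trans (cong sign (edges-reverseʷ Q₁)) (sign-↭ (↭-reverse (edges Q₁)))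

  close-ear : ∀ {c a b} {C : Circle c} (E : Ear C a b) (B : BackArc C a b) →
    Σ (Circle a) λ D → sign (edges (walk D)) ≡ sign (edges (Ear.path E)) * sign (edges (back B))
  close-ear (ear P a≢b _ _ uVᴾ uEᴾ inner avoids) (backArc Q uVQ uEQ a∉Q Q⊆C Q⊆Cᵉ) =
    glued , sign-++ʷ P Q disjE
    where
      disjV : Disjoint (vertices P) (vertices Q)
      disjV (p , q) with inner p (Q⊆C q)
      ... | refl = a∉Q q
      disjE : Disjoint (edges P) (edges Q)
      disjE (p , q) = avoids p (Q⊆Cᵉ q)
      glued : Circle _
      glued = circle (P ++ʷ Q)
        (λ eq → distinct⇒nonempty P a≢b (++-conicalˡ (edges P) (edges Q) (trans (sym (edges-++ʷ P Q)) eq)))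
        (subst Unique (sym (vertices-++ʷ P Q)) (++⁺ uVᴾ uVQ disjV))
        (subst Unique (sym (edges-++ʷ P Q)) (++⁺ uEᴾ uEQ disjE))

  -- Theta lemma: an ear closes a circle with each of the two ways back, and
  -- the signs of these circles multiply to the sign of C.  So if C is
  -- negative, one of them is positive.
  ear⇒positive : ∀ {c a b} (C : Circle c) → sign (edges (walk C)) ≡ minus → Ear C a b → ∃[ X ] PositiveCycle G X
  ear⇒positive C negative E with two-ways-back C (Ear.distinct E) (splitCircle C (Ear.start∈C E) (Ear.end∈C E))
  ... | (B₁ , B₂) , sign-C with close-ear E B₁ | close-ear E B₂
  ...   | D₁ , sign₁ | D₂ , sign₂ = [ positive-circle D₁ , positive-circle D₂ ]′ (*-minus _ _ product)
    where
      open ≡-Reasoning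
      sᴾ = sign (edges (Ear.path E))
      product : sign (edges (walk D₁)) * sign (edges (walk D₂)) ≡ minus
      product = begin
        sign (edges (walk D₁)) * sign (edges (walk D₂))              ≡⟨ cong₂ _*_ sign₁ sign₂ ⟩
        (sᴾ * sign (edges (back B₁))) * (sᴾ * sign (edges (back B₂))) ≡⟨ theta-sign sᴾ _ _ ⟩
        sign (edges (back B₁)) * sign (edges (back B₂))              ≡⟨ trans (sym sign-C) negative ⟩
        minus                                                        ∎

  module EarSearch {c} (C : Circle c) where

    VC : List (Vertex G)
    VC = vertices (walk C)

    EC : List (Edge G)
    EC = edges (walk C)

    onC? : ∀ z → Dec (z ∈ VC)
    onC? z = Any.any? (z ≟ᶠ_) VC

    alongC? : ∀ g → Dec (g ∈ EC)
    alongC? g = Any.any? (g ≟ᶠ_) EC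

    record Return {z y} (W : Walk z y) : Set where
      constructor return
      field
        {point}         : Vertex G
        outside         : Walk z point
        rest            : Walk point y
        point∈C         : point ∈ VC
        offV            : ∀ {u} → u ∈ vertices outside → u ∉ VC
        offE            : ∀ {g} → g ∈ edges outside → g ∉ EC
        vertices-return : vertices W ≡ vertices outside ++ vertices rest
        edges-return    : edges W ≡ edges outside ++ edges rest

    firstReturn : ∀ {z y} (W : Walk z y) → z ∉ VC → y ∈ VC → Return W
    firstReturn nil z∉ y∈ = ⊥-elim (z∉ y∈)
    firstReturn (step g j W) z∉ y∈ with onC? _
    ... | yes z′∈ = return (step g j nil) W z′∈ (λ { (here refl) → z∉ })
                      (λ { (here refl) g∈ → z∉ (Incident⇒onCircle C g∈ (Joins⇒Incidentˡ j)) }) refl refl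
    ... | no z′∉ with firstReturn W z′∉ y∈
    ... | return P R p∈ offV offE pv pe =
      return (step g j P) R p∈ (λ { (here refl) → z∉ ; (there q) → offV q })
        (λ { (here refl) g∈ → z∉ (Incident⇒onCircle C g∈ (Joins⇒Incidentˡ j)) ; (there q) → offE q })
        (cong (_ ∷_) pv) (cong (g ∷_) pe)

    -- A decomposition W = before ++ path ++ after in which path is an ear
    -- of C, except that its ends need not yet be distinct.
    record EarIn {x y} (W : Walk x y) : Set where
      constructor earIn
      field
        {left right}  : Vertex G
        before        : Walk x left
        path          : Walk left right
        after         : Walk right y
        left∈C        : left ∈ VC
        right∈C       : right ∈ VC
        nonempty-path : edges path ≢ []
        inner         : ∀ {u} → u ∈ vertices path → u ∈ VC → u ≡ left
        avoids        : ∀ {g} → g ∈ edges path → g ∉ EC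
        vertices-ear  : vertices W ≡ vertices before ++ vertices path ++ vertices after
        edges-ear     : edges W ≡ edges before ++ edges path ++ edges after

    -- A walk between vertices of C using an edge off C leaves C along its
    -- first such edge and contains an ear starting there.
    findEar : ∀ {x y} (W : Walk x y) → x ∈ VC → y ∈ VC → ∀ {g} → g ∈ edges W → g ∉ EC → EarIn W
    findEar (step g j W) x∈ y∈ g∈ g∉ with alongC? g
    findEar (step g j W) x∈ y∈ (here refl) g∉ | yes g∈C = ⊥-elim (g∉ g∈C)
    findEar (step g j W) x∈ y∈ (there q) g∉ | yes g∈C
      with findEar W (Incident⇒onCircle C g∈C (Joins⇒Incidentʳ j)) y∈ q g∉
    ... | earIn A P B l∈ r∈ ne inner avoids pv pe =
      earIn (step g j A) P B l∈ r∈ ne inner avoids (cong (_ ∷_) pv) (cong (g ∷_) pe)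
    findEar (step g j W) x∈ y∈ _ g∉ | no g∉C with onC? _
    ... | yes z∈ = earIn nil (step g j nil) W x∈ z∈ (λ ()) (λ { (here refl) _ → refl })
                     (λ { (here refl) → g∉C }) refl refl
    ... | no z∉ with firstReturn W z∉ y∈
    ... | return P R p∈ offV offE pv pe =
      earIn nil (step g j P) R x∈ p∈ (λ ())
        (λ { (here refl) _ → refl ; (there q) u∈ → ⊥-elim (offV q u∈) })
        (λ { (here refl) → g∉C ; (there q) → offE q }) (cong (_ ∷_) pv) (cong (g ∷_) pe)

    -- In a closed walk x → left → left → x without repeated vertices, the
    -- middle part (nonempty, meeting C only at left) leaves no room for a
    -- second vertex y ≢ x of C.
    closed-ear-absurd : ∀ {x l} (A : Walk x l) (P : Walk l l) (B : Walk l x) → edges P ≢ [] →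
      Unique (vertices A ++ vertices P ++ vertices B) → (∀ {u} → u ∈ vertices P → u ∈ VC → u ≡ l) →
      ∀ {y} → y ∈ vertices A ++ vertices P ++ vertices B → y ∈ VC → y ≢ x → ⊥
    closed-ear-absurd nil P nil ne u inner y∈ y∈C y≢x =
      y≢x (inner (subst (_ ∈_) (++-identityʳ (vertices P)) y∈) y∈C)
    closed-ear-absurd A P (step _ _ _) ne u inner y∈ y∈C y≢x =
      proj₂ (proj₂ (Unique-++⁻ (vertices P) (proj₁ (proj₂ (Unique-++⁻ (vertices A) u)))))
        (start∈vertices P ne , here refl)
    closed-ear-absurd A@(step _ _ _) P nil ne u inner y∈ y∈C y≢x =
      proj₂ (proj₂ (Unique-++⁻ (vertices A) u)) (here refl , ∈-++⁺ˡ (start∈vertices P ne))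

    ear-in-circle : ∀ {x y} (D : Circle x) → x ∈ VC → y ∈ vertices (walk D) → y ∈ VC → y ≢ x →
      ∀ {g} → g ∈ edges (walk D) → g ∉ EC → ∃₂ λ a b → Ear C a b
    ear-in-circle D x∈C y∈D y∈C y≢x g∈ g∉ with findEar (walk D) x∈C x∈C g∈ g∉
    ... | earIn {l} {r} A P B l∈ r∈ ne inner avoids pv pe =
      l , r , ear P distinct l∈ r∈ (proj₁ (Unique-++⁻ (vertices P) (proj₁ (proj₂ (Unique-++⁻ (vertices A) uV)))))
        (proj₁ (Unique-++⁻ (edges P) (proj₁ (proj₂ (Unique-++⁻ (edges A) uE))))) inner avoids
      where
        uV : Unique (vertices A ++ vertices P ++ vertices B)
        uV = subst Unique pv (uniqueV D)
        uE : Unique (edges A ++ edges P ++ edges B)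
        uE = subst Unique pe (uniqueE D)
        distinct : l ≢ r
        distinct refl = closed-ear-absurd A P B ne uV inner (subst (_ ∈_) pv y∈D) y∈C y≢x

  shared-vertices⇒positive : ∀ {c d} (C : Circle c) (D : Circle d) → sign (edges (walk C)) ≡ minus →
    ∀ {x y} → x ≢ y → x ∈ vertices (walk C) → y ∈ vertices (walk C) →
    x ∈ vertices (walk D) → y ∈ vertices (walk D) →
    ∀ {g} → g ∈ edges (walk D) → g ∉ edges (walk C) → ∃[ X ] PositiveCycle G X
  shared-vertices⇒positive C D negative x≢y x∈C y∈C x∈D y∈D g∈D g∉C with rotate D x∈D
  ... | rotation D′ vs↭ es↭ with EarSearch.ear-in-circle C D′ x∈C (∈-resp-↭ vs↭ y∈D) y∈C (x≢y ∘ sym) (∈-resp-↭ es↭ g∈D) g∉C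
  ... | _ , _ , E = ear⇒positive C negative E

  loop-joins : ∀ {e v p q} → Joins G e v v → Joins G e p q → p ≡ q
  loop-joins {e} l j = Equivalence.to (between-ends {R = _≡_} sym j) ends-equal
    where
      ends-equal : end₁ e ≡ end₂ e
      ends-equal = Equivalence.from (between-ends {R = _≡_} sym l) refl

  no-detour : ∀ {c p} (A : Walk c p) (B : Walk p c) → Unique (vertices A ++ p ∷ vertices B) →
    edges A ≡ [] × edges B ≡ []
  no-detour nil nil _ = refl , refl
  no-detour A (step _ _ _) u = ⊥-elim (All.lookup (head (proj₁ (proj₂ (Unique-++⁻ (vertices A) u)))) (here refl) refl)
  no-detour (step _ _ A) nil u = ⊥-elim (All.lookup (head u) (∈-++⁺ʳ (vertices A) (here refl)) refl)

  loop-circle : ∀ {c} (C : Circle c) {e v} → e ∈ edges (walk C) → Joins G e v v → edges (walk C) ≡ [ e ]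
  loop-circle C e∈ l with cutAtEdge (walk C) e∈
  ... | edgeCut A j B pv pe with loop-joins l j
  ... | refl with no-detour A B (subst Unique pv (uniqueV C))
  ... | A-empty , B-empty = trans pe (cong₂ (λ xs ys → xs ++ _ ∷ ys) A-empty B-empty)

  first-edge : ∀ {c} (C : Circle c) → ∃₂ λ e z → e ∈ edges (walk C) × Joins G e c z
  first-edge (circle nil ne _ _) = ⊥-elim (ne refl)
  first-edge (circle (step e j _) _ _ _) = e , _ , here refl , j

  module _ {C} (Cᶜ : CircleOn C) where

    onCircle⁻ : ∀ {e} → e ∈ edges (walk (theCircle Cᶜ)) → e ∈ₛ C
    onCircle⁻ {e} p = subst (e ∈ₛ_) (edgeSet-circle Cᶜ) (∈-edgeSet⁺ _ p)

    onCircle⁺ : ∀ {e} → e ∈ₛ C → e ∈ edges (walk (theCircle Cᶜ))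
    onCircle⁺ {e} p = ∈-edgeSet⁻ _ (subst (e ∈ₛ_) (sym (edgeSet-circle Cᶜ)) p)

    VOf⇒onCircle : ∀ {x} → VOf G C x → x ∈ vertices (walk (theCircle Cᶜ))
    VOf⇒onCircle (e , e∈C , inc) = Incident⇒onCircle (theCircle Cᶜ) (onCircle⁺ e∈C) inc

    sign-circle : sign (edges (walk (theCircle Cᶜ))) ≡ signOf G C
    sign-circle = cong (signOf G) (edgeSet-circle Cᶜ)

  VOf? : ∀ X x → Dec (VOf G X x)
  VOf? X x = any? (λ e → (e ∈ₛ? X) ×-dec ((end₁ e ≟ᶠ x) ⊎-dec (end₂ e ≟ᶠ x)))

  Adj-sym : ∀ {S a b} → Adj G S a b → Adj G S b a
  Adj-sym (e , e∈ , j) = e , e∈ , Joins-sym j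

  reach-sym : ∀ {S a b} → Reach G S a b → Reach G S b a
  reach-sym = Star.reverse Adj-sym

  reach-mono : ∀ {S S′ a b} → S ⊆ S′ → Reach G S a b → Reach G S′ a b
  reach-mono S⊆S′ = Star.map λ { (e , e∈ , j) → e , S⊆S′ e∈ , j }

  walk⇒reach : ∀ {S a b} (w : Walk a b) → (∀ {g} → g ∈ edges w → g ∈ₛ S) → Reach G S a b
  walk⇒reach nil _ = ε
  walk⇒reach (step e j w) inS = (e , inS (here refl) , j) ◅ walk⇒reach w (inS ∘ there)

  reach⇒walk : ∀ {S a b} → Reach G S a b → Σ (Walk a b) λ w → ∀ {g} → g ∈ edges w → g ∈ₛ S
  reach⇒walk ε = nil , λ ()
  reach⇒walk ((e , e∈ , j) ◅ r) with reach⇒walk r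
  ... | w , inS = step e j w , λ { (here refl) → e∈ ; (there q) → inS q }

  length-visited : ∀ {a b} (w : Walk a b) → length (visited w) ≡ suc (length (edges w))
  length-visited nil = refl
  length-visited (step e j w) = cong suc (length-visited w)

  path-edges-unique : ∀ {a b} (w : Walk a b) → Unique (visited w) → Unique (edges w)
  path-edges-unique nil _ = []
  path-edges-unique (step e j w) (a∉ ∷ u) =
    ¬Any⇒All¬ (edges w) (λ e∈ → All.lookup a∉ (Incident⇒visited w e∈ (Joins⇒Incidentˡ j)) refl) ∷ path-edges-unique w u

  erase : ∀ {a b} (w : Walk a b) → Σ (Walk a b) λ p → Unique (visited p) × (∀ {g} → g ∈ edges p → g ∈ edges w)
  erase nil = nil , All.[] ∷ [] , λ ()
  erase {a} (step e j w) with erase w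
  ... | p , u , sub with Any.any? (a ≟ᶠ_) (visited p)
  ...   | no a∉ = step e j p , ¬Any⇒All¬ _ a∉ ∷ u , λ { (here refl) → here refl ; (there q) → there (sub q) }
  ...   | yes a∈ with cutAt p a∈
  ...     | cut A B pv pe = B , proj₁ (proj₂ (Unique-++⁻ (vertices A) (subst Unique visited-cut u))) ,
                            λ q → there (sub (subst (_ ∈_) (sym pe) (∈-++⁺ʳ (edges A) q)))
    where
      visited-cut : visited p ≡ vertices A ++ visited B
      visited-cut = begin
        visited p                               ≡⟨ vertices-visited p ⟨
        vertices p ++ [ _ ]                     ≡⟨ cong (_++ [ _ ]) pv ⟩
        (vertices A ++ vertices B) ++ [ _ ]     ≡⟨ ++-assoc (vertices A) (vertices B) [ _ ] ⟩
        vertices A ++ vertices B ++ [ _ ]       ≡⟨ cong (vertices A ++_) (vertices-visited B) ⟩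
        vertices A ++ visited B                 ∎
        where open ≡-Reasoning

  -- Reachability is decidable: it suffices to search walks with at most
  -- n G edges, as loop erasure shows.
  module _ (S : EdgeSet G) where

    ReachWithin : ℕ → Vertex G → Vertex G → Set
    ReachWithin zero u v = u ≡ v
    ReachWithin (suc t) u v = (u ≡ v) ⊎ ∃[ w ] (Adj G S u w × ReachWithin t w v)

    Joins? : ∀ e u v → Dec (Joins G e u v)
    Joins? e u v = (×-≡-dec _≟ᶠ_ _≟ᶠ_ (ends G e) (u , v)) ⊎-dec (×-≡-dec _≟ᶠ_ _≟ᶠ_ (ends G e) (v , u))

    within? : ∀ t u v → Dec (ReachWithin t u v)
    within? zero u v = u ≟ᶠ v
    within? (suc t) u v = (u ≟ᶠ v) ⊎-dec any? (λ w → any? (λ e → (e ∈ₛ? S) ×-dec Joins? e u w) ×-dec within? t w v)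

    within⇒reach : ∀ t {u v} → ReachWithin t u v → Reach G S u v
    within⇒reach zero refl = ε
    within⇒reach (suc t) (inj₁ refl) = ε
    within⇒reach (suc t) (inj₂ (w , adj , r)) = adj ◅ within⇒reach t r

    walk⇒within : ∀ {u v} (w : Walk u v) → (∀ {g} → g ∈ edges w → g ∈ₛ S) → ∀ t → length (edges w) ≤ t → ReachWithin t u v
    walk⇒within nil _ zero _ = refl
    walk⇒within nil _ (suc t) _ = inj₁ refl
    walk⇒within (step e j w) inS (suc t) (s≤s len≤) =
      inj₂ (_ , (e , inS (here refl) , j) , walk⇒within w (inS ∘ there) t len≤)

    reach? : ∀ u v → Dec (Reach G S u v)
    reach? u v with within? (n G) u v
    ... | yes r = yes (within⇒reach (n G) r)
    ... | no ¬r = no λ r → let (w , inS) = reach⇒walk r ; (p , up , sub) = erase w in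
      ¬r (walk⇒within p (inS ∘ sub) (n G) (≤-trans (n≤1+n _) (subst (_≤ n G) (length-visited p) (Unique-length≤ up))))

  components : ∀ S → ∃[ j ] NumComponents G S j
  components S = labelling (Reach G S) (λ _ → ε) reach-sym _◅◅_ (reach? S)

  OnCycle : Edge G → Set
  OnCycle e = ∃[ C ] (IsCycle G C × e ∈ₛ C)

  -- An edge lies on a cycle once its ends are joined by a walk avoiding it:
  -- the edge followed by the erased walk is a circle.
  detour⇒onCycle : ∀ e → Reach G (∁ ⁅ e ⁆) (end₂ e) (end₁ e) → OnCycle e
  detour⇒onCycle e r with reach⇒walk r
  ... | w , avoids with erase w
  ... | p , up , sub = edgeSet (edges (walk C)) , circle→cycle C , ∈-edgeSet⁺ (edges (walk C)) (here refl)
    where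
      uV = Unique-++⁻ (vertices p) (subst Unique (sym (vertices-visited p)) up)
      C : Circle (end₁ e)
      C = circle (step e (inj₁ refl) p) (λ ())
        (¬Any⇒All¬ _ (λ a∈ → proj₂ (proj₂ uV) (a∈ , here refl)) ∷ proj₁ uV)
        (¬Any⇒All¬ _ (λ e∈ → x∈∁p⇒x∉p (avoids (sub e∈)) (x∈⁅x⁆ e)) ∷ path-edges-unique p up)

  -- Conversely, the rest of a cycle joins the ends of each of its edges.
  onCycle⇒detour : ∀ {e} → OnCycle e → Reach G (∁ ⁅ e ⁆) (end₁ e) (end₂ e)
  onCycle⇒detour {e} (C , cyc , e∈C) = around (cycle→circle cyc)
    where
      around : CircleOn C → Reach G (∁ ⁅ e ⁆) (end₁ e) (end₂ e)
      around Cᶜ with cutAtEdge (walk (theCircle Cᶜ)) (onCircle⁺ Cᶜ e∈C)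
      ... | edgeCut A j B _ pe =
        Equivalence.from (between-ends reach-sym j) (reach-sym (walk⇒reach (B ++ʷ A) avoids))
        where
          uE = Unique-++⁻ (edges A) (subst Unique pe (uniqueE (theCircle Cᶜ)))
          avoids : ∀ {g} → g ∈ edges (B ++ʷ A) → g ∈ₛ ∁ ⁅ e ⁆
          avoids {g} g∈ = x∉p⇒x∈∁p λ g∈⁅e⁆ → twice (subst (_∈ edges B ++ edges A) (x∈⁅y⁆⇒x≡y e g∈⁅e⁆)
                                                         (subst (g ∈_) (edges-++ʷ B A) g∈))
            where
              twice : e ∈ edges B ++ edges A → ⊥
              twice q with ∈-++⁻ (edges B) q
              ... | inj₁ e∈B = All.lookup (head (proj₁ (proj₂ uE))) e∈B refl
              ... | inj₂ e∈A = proj₂ (proj₂ uE) (e∈A , here refl)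

  onCycle? : ∀ e → OnCycle e ⊎ ¬ Reach G (∁ ⁅ e ⁆) (end₁ e) (end₂ e)
  onCycle? e with reach? (∁ ⁅ e ⁆) (end₂ e) (end₁ e)
  ... | yes r = inj₁ (detour⇒onCycle e r)
  ... | no ¬r = inj₂ (¬r ∘ reach-sym)

  separating⇒isthmus : ∀ {e} → ¬ Reach G (∁ ⁅ e ⁆) (end₁ e) (end₂ e) → Isthmus G e
  separating⇒isthmus {e} separated with components ⊤ | components (∁ ⁅ e ⁆)
  ... | k , L | k′ , L′ = k , k′ , L , L′ ,
    Coarsening.strictly-fewer-classes (reach-mono (λ _ → ∈⊤)) L′ L ((e , ∈⊤ , inj₁ refl) ◅ ε) separated

  -- Deleting an edge on a cycle changes no connection, as the rest of the
  -- cycle replaces it.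
  onCycle⇒¬isthmus : ∀ {e} → OnCycle e → ¬ Isthmus G e
  onCycle⇒¬isthmus {e} oc (k , k′ , L , L′ , k<k′) = <⇒≱ k<k′ (Coarsening.fewer-classes avoid L L′)
    where
      step-avoid : ∀ {u v} → Adj G ⊤ u v → Reach G (∁ ⁅ e ⁆) u v
      step-avoid (g , _ , j) with g ≟ᶠ e
      ... | no g≢e = (g , x∉p⇒x∈∁p (x≢y⇒x∉⁅y⁆ g≢e) , j) ◅ ε
      ... | yes refl = Equivalence.to (between-ends reach-sym j) (onCycle⇒detour oc)
      avoid : ∀ {u v} → Reach G ⊤ u v → Reach G (∁ ⁅ e ⁆) u v
      avoid ε = ε
      avoid (s ◅ r) = step-avoid s ◅◅ avoid r

  ¬isthmus⇒onCycle : ∀ {e} → ¬ Isthmus G e → OnCycle e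
  ¬isthmus⇒onCycle {e} ¬isthmus with onCycle? e
  ... | inj₁ oc = oc
  ... | inj₂ separated = ⊥-elim (¬isthmus (separating⇒isthmus separated))

  union⇒cycles : ∀ {C D e} → IsCycle G C → IsCycle G D → C ≢ D → e ∈ₛ C ∪ D →
    ∃[ C′ ] (IsCycle G C′ × e ∈ₛ C′ × ∃[ D′ ] (IsCycle G D′ × D′ ≢ C′))
  union⇒cycles {C} {D} cycC cycD C≢D e∈ with x∈p∪q⁻ C D e∈
  ... | inj₁ e∈C = C , cycC , e∈C , D , cycD , C≢D ∘ sym
  ... | inj₂ e∈D = D , cycD , e∈D , C , cycC , C≢D

  another-cycle : AtLeastTwoCycles G → ∀ C → ∃[ D ] (IsCycle G D × C ≢ D)
  another-cycle (C₁ , C₂ , cyc₁ , cyc₂ , C₁≢C₂) C with Vec-≡-dec _≟ᵇ_ C C₁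
  ... | yes refl = C₂ , cyc₂ , C₁≢C₂
  ... | no C≢C₁ = C₁ , cyc₁ , C≢C₁

  liftConnected⇒¬liftIsthmus : 2 ≤ m G → LiftConnected G → ∀ e → ¬ LiftIsthmus G e
  liftConnected⇒¬liftIsthmus two (inj₁ connected) e isthmus with another two e
  ... | f , e≢f with connected e f e≢f
  ... | X , circuit , e∈X , _ = isthmus X circuit e∈X
  liftConnected⇒¬liftIsthmus _ (inj₂ (_ , m≡0)) e _ with subst Fin m≡0 e
  ... | ()

  module AllCyclesNegative (noPositive : NoPositiveCycle G) where

    negative : ∀ {C} → IsCycle G C → signOf G C ≡ minus
    negative {C} cyc with signOf G C in eq
    ... | plus = ⊥-elim (noPositive C (cyc , eq))
    ... | minus = refl

    negative-circle : ∀ {C} → IsCycle G C → (Cᶜ : CircleOn C) → sign (edges (walk (theCircle Cᶜ))) ≡ minus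
    negative-circle cyc Cᶜ = trans (sign-circle Cᶜ) (negative cyc)

    -- Through two common vertices a cycle D cannot leave a cycle C: an
    -- edge of D off C would make D contain an ear of C.
    shared-vertices⇒⊆ : ∀ {C D} → IsCycle G C → IsCycle G D → ∀ {x y} → x ≢ y →
      VOf G C x → VOf G C y → VOf G D x → VOf G D y → D ⊆ C
    shared-vertices⇒⊆ {C} {D} cycC cycD x≢y xC yC xD yD with ⊆-or-witness D C
    ... | inj₁ D⊆C = D⊆C
    ... | inj₂ (g , g∈D , g∉C) = ⊥-elim (uncurry noPositive
      (shared-vertices⇒positive (theCircle Cᶜ) (theCircle Dᶜ) (negative-circle cycC Cᶜ) x≢y
        (VOf⇒onCircle Cᶜ xC) (VOf⇒onCircle Cᶜ yC) (VOf⇒onCircle Dᶜ xD) (VOf⇒onCircle Dᶜ yD)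
        (onCircle⁺ Dᶜ g∈D) (g∉C ∘ onCircle⁻ Cᶜ)))
      where
        Cᶜ = cycle→circle cycC
        Dᶜ = cycle→circle cycD

    common-vertex-unique : ∀ {C D} → IsCycle G C → IsCycle G D → C ≢ D →
      ∀ {x y} → VOf G C x → VOf G D x → VOf G C y → VOf G D y → y ≡ x
    common-vertex-unique cycC cycD C≢D {x} {y} xC xD yC yD with y ≟ᶠ x
    ... | yes y≡x = y≡x
    ... | no y≢x = ⊥-elim (C≢D (⊆-antisym (shared-vertices⇒⊆ cycD cycC (y≢x ∘ sym) xD yD xC yC)
                                           (shared-vertices⇒⊆ cycC cycD (y≢x ∘ sym) xC yC xD yD)))

    -- Two distinct cycles form a lift circuit: they meet in at most one vertex.
    two-cycles⇒circuit : ∀ {C D} → IsCycle G C → IsCycle G D → C ≢ D → LiftCircuit G (C ∪ D)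
    two-cycles⇒circuit {C} {D} cycC cycD C≢D with any? (λ x → VOf? C x ×-dec VOf? D x)
    ... | no none = inj₂ (inj₂ (C , D , (cycC , negative cycC) , (cycD , negative cycD) , C≢D ,
                                (λ x xC xD → none (x , xC , xD)) , refl))
    ... | yes (x , xC , xD) = inj₂ (inj₁ (C , D , (cycC , negative cycC) , (cycD , negative cycD) , C≢D ,
                                (x , xC , xD , λ y yC yD → common-vertex-unique cycC cycD C≢D xC xD yC yD) , refl))

    -- A cycle contained in a cycle equals it.  If the first edge of the
    -- smaller one is a loop, the larger cycle is that loop; otherwise the two
    -- cycles share both ends of that edge.
    cycle⊆cycle : ∀ {C D} → IsCycle G C → IsCycle G D → D ⊆ C → D ≡ C
    cycle⊆cycle {C} {D} cycC cycD = via (cycle→circle cycC) (cycle→circle cycD)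
      where
        via : CircleOn C → CircleOn D → D ⊆ C → D ≡ C
        via Cᶜ Dᶜ D⊆C with first-edge (theCircle Dᶜ)
        ... | e , z , e∈ , j with z ≟ᶠ start Dᶜ
        ...   | yes refl = ⊆-antisym D⊆C λ {g} g∈C → subst (_∈ₛ D) (sym (only-e g∈C)) e∈D
          where
            e∈D : e ∈ₛ D
            e∈D = onCircle⁻ Dᶜ e∈
            only-e : ∀ {g} → g ∈ₛ C → g ≡ e
            only-e {g} g∈C with subst (g ∈_) (loop-circle (theCircle Cᶜ) (onCircle⁺ Cᶜ (D⊆C e∈D)) j) (onCircle⁺ Cᶜ g∈C)
            ... | here g≡e = g≡e
        ...   | no z≢d = ⊆-antisym D⊆C (shared-vertices⇒⊆ cycD cycC (z≢d ∘ sym)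
                  (e , e∈D , Joins⇒Incidentˡ j) (e , e∈D , Joins⇒Incidentʳ j)
                  (e , D⊆C e∈D , Joins⇒Incidentˡ j) (e , D⊆C e∈D , Joins⇒Incidentʳ j))
          where
            e∈D : e ∈ₛ D
            e∈D = onCircle⁻ Dᶜ e∈

    circuit⇒cycles : ∀ {X e} → LiftCircuit G X → e ∈ₛ X →
      ∃[ C ] (IsCycle G C × e ∈ₛ C × ∃[ D ] (IsCycle G D × D ≢ C))
    circuit⇒cycles (inj₁ positive) _ = ⊥-elim (noPositive _ positive)
    circuit⇒cycles (inj₂ (inj₁ (_ , _ , (cycC , _) , (cycD , _) , C≢D , _ , refl))) = union⇒cycles cycC cycD C≢D
    circuit⇒cycles (inj₂ (inj₂ (_ , _ , (cycC , _) , (cycD , _) , C≢D , _ , refl))) = union⇒cycles cycC cycD C≢D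

    offCycle⇒liftIsthmus : ∀ {e} → ¬ OnCycle e → LiftIsthmus G e
    offCycle⇒liftIsthmus offCycle X circuit e∈X with circuit⇒cycles circuit e∈X
    ... | C , cycC , e∈C , _ = offCycle (C , cycC , e∈C)

    fewCycles⇒liftIsthmus : ¬ AtLeastTwoCycles G → ∀ e → LiftIsthmus G e
    fewCycles⇒liftIsthmus few e X circuit e∈X with circuit⇒cycles circuit e∈X
    ... | C , cycC , _ , D , cycD , D≢C = few (D , C , cycD , cycC , D≢C)

    ¬liftIsthmus⇒onCycle : ∀ {e} → ¬ LiftIsthmus G e → OnCycle e
    ¬liftIsthmus⇒onCycle {e} ¬isthmus with onCycle? e
    ... | inj₁ oc = oc
    ... | inj₂ separated = ⊥-elim (¬isthmus (offCycle⇒liftIsthmus (separated ∘ onCycle⇒detour)))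

    -- Conversely, with two cycles an edge on a cycle C shares with it the
    -- circuit C ∪ D for any other cycle D.
    cycles⇒¬liftIsthmus : AtLeastTwoCycles G → ∀ {e} → OnCycle e → ¬ LiftIsthmus G e
    cycles⇒¬liftIsthmus two (C , cycC , e∈C) isthmus with another-cycle two C
    ... | D , cycD , C≢D = isthmus (C ∪ D) (two-cycles⇒circuit cycC cycD C≢D) (x∈p∪q⁺ (inj₁ e∈C))

    -- Without lift isthmuses there are two cycles: a cycle C through an edge
    -- either misses some edge, whose cycle then differs from C, or contains
    -- every edge, and then no circuit could contain two distinct cycles.
    ¬liftIsthmus⇒twoCycles : (∀ e → ¬ LiftIsthmus G e) → Edge G → AtLeastTwoCycles G
    ¬liftIsthmus⇒twoCycles none e₀ with ¬liftIsthmus⇒onCycle (none e₀)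
    ... | C , cycC , _ with ⊆-or-witness ⊤ C
    ...   | inj₂ (g , _ , g∉C) with ¬liftIsthmus⇒onCycle (none g)
    ...     | D , cycD , g∈D = C , D , cycC , cycD , λ C≡D → g∉C (subst (g ∈ₛ_) (sym C≡D) g∈D)
    ¬liftIsthmus⇒twoCycles none e₀ | C , cycC , _ | inj₁ ⊤⊆C = ⊥-elim (none e₀ no-circuit)
      where
        no-circuit : LiftIsthmus G e₀
        no-circuit X circuit e∈X with circuit⇒cycles circuit e∈X
        ... | C′ , cycC′ , _ , D , cycD , D≢C′ =
          D≢C′ (trans (cycle⊆cycle cycC cycD (λ _ → ⊤⊆C ∈⊤)) (sym (cycle⊆cycle cycC cycC′ (λ _ → ⊤⊆C ∈⊤))))

    -- With two cycles and every edge on a cycle, any two edges lie on the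
    -- union of two distinct cycles, which is a lift circuit.
    cycles⇒liftConnected : AtLeastTwoCycles G → (∀ e → OnCycle e) → LiftMatroidConnected G
    cycles⇒liftConnected two onCycle e f _ with onCycle e | onCycle f
    ... | Cᵉ , cycᵉ , e∈ | Cᶠ , cycᶠ , f∈ with Vec-≡-dec _≟ᵇ_ Cᵉ Cᶠ
    ...   | no Cᵉ≢Cᶠ = Cᵉ ∪ Cᶠ , two-cycles⇒circuit cycᵉ cycᶠ Cᵉ≢Cᶠ , x∈p∪q⁺ (inj₁ e∈) , x∈p∪q⁺ (inj₂ f∈)
    ...   | yes refl with another-cycle two Cᵉ
    ...     | D , cycD , Cᵉ≢D = Cᵉ ∪ D , two-cycles⇒circuit cycᵉ cycD Cᵉ≢D , x∈p∪q⁺ (inj₁ e∈) , x∈p∪q⁺ (inj₁ f∈)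

open Graph

-- (1) ⇔ (2), (2) ⇔ (3), and the final claim, each via "two cycles and every
-- edge on a cycle".
theorem5p6 : (G : SignedGraph) → NoPositiveCycle G → 2 ≤ m G → NoIsolatedVertex G →
    (LiftConnected G ⇔ (∀ e → ¬ LiftIsthmus G e))
    × ((∀ e → ¬ LiftIsthmus G e) ⇔ (AtLeastTwoCycles G × (∀ e → ¬ Isthmus G e)))
    × (¬ AtLeastTwoCycles G → ∀ e → LiftIsthmus G e)
theorem5p6 G noPositive two-edges _ =
    mk⇔ (liftConnected⇒¬liftIsthmus G two-edges)
        (λ none → inj₁ (cycles⇒liftConnected (twoCycles none) (λ e → ¬liftIsthmus⇒onCycle (none e))))
  , mk⇔ (λ none → twoCycles none , λ e → onCycle⇒¬isthmus G (¬liftIsthmus⇒onCycle (none e)))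
        (λ { (two , noIsthmus) e → cycles⇒¬liftIsthmus two (¬isthmus⇒onCycle G (noIsthmus e)) })
  , fewCycles⇒liftIsthmus
  where
    open AllCyclesNegative G noPositive
    twoCycles : (∀ e → ¬ LiftIsthmus G e) → AtLeastTwoCycles G
    twoCycles none = ¬liftIsthmus⇒twoCycles none (fromℕ< two-edges)
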